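{- Define the Bell polynomials of the second kind $\mathrm{bel}_n(x)$ ($n\ge1$) by \[ \log\big(1+x\log(1+t)\big)=\sum_{n=1}^{\infty}\mathrm{bel}_{n}(x)\frac{t^{n}}{n!}. \] Then for every $n\ge 0$, \[ \sum_{k=0}^{n}\mathrm{bel}_{k+1}(-1)S_{2}(n,k)=-d_{n}, \] where $d_n$ is the $n$-th derangement number.
   Context: Equivalently, $\mathrm{bel}_n(x)=\sum_{k=1}^n(-1)^{k-1}(k-1)!S_1(n,k)x^k$, where the (signed) Stirling numbers of the first kind are given by $\frac{1}{k!}(\log(1+t))^k=\sum_{n\ge k}S_1(n,k)\frac{t^n}{n!}$. The Stirling numbers of the second kind are given by $\frac{1}{k!}(e^t-1)^k=\sum_{n\ge k}S_2(n,k)\frac{t^n}{n!}$ (with $S_2(0,0)=1$, $S_2(n,0)=0$ for $n\ge1$). The derangement numbers $d_n$ (number of fixed-point-free permutations of $n$ elements) satisfy $\frac{e^{ -t}}{1-t}=\sum_{n\ge0}d_n\frac{t^n}{n!}$. All series are formal power series. -}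

module Defs where

open import Data.Nat as ℕ using (ℕ; zero; suc; _!; _∸_)
open import Data.Nat.Properties using (_!≢0)
open import Data.Integer as ℤ using (+_; -[1+_])
open import Data.Rational using (ℚ; _+_; _*_; -_; 0ℚ; 1ℚ; _/_)

-- Finite sum  Σ_{i=0}^{n} f i  (inclusive upper bound n).
sumTo : ℕ → (ℕ → ℚ) → ℚ
sumTo zero    f = f 0
sumTo (suc n) f = sumTo n f + f (suc n)

-- Finite sum  Σ_{j=0}^{n-1} f j  (i.e. Σ_{k=1}^{n} f (k-1); empty for n = 0).
sumBelow : ℕ → (ℕ → ℚ) → ℚ
sumBelow zero    f = 0ℚ
sumBelow (suc n) f = sumBelow n f + f n

sgn : ℕ → ℚ
sgn zero    = 1ℚ
sgn (suc n) = - sgn n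

fact : ℕ → ℚ
fact n = (+ (n !)) / 1

invFact : ℕ → ℚ
invFact n = _/_ (+ 1) (n !) {{n !≢0}}

-- Formal power series over ℚ, as coefficient sequences: f n = [t^n] f.
PS : Set
PS = ℕ → ℚ

_⊛_ : PS → PS → PS
(f ⊛ g) n = sumTo n (λ i → f i * g (n ∸ i))

pow : PS → ℕ → PS
pow f zero    zero    = 1ℚ
pow f zero    (suc n) = 0ℚ
pow f (suc k)         = f ⊛ pow f k

scale : ℚ → PS → PS
scale c f n = c * f n

-- log(1+t) = Σ_{n≥1} (-1)^{n-1} t^n / n
log1p : PS
log1p zero    = 0ℚ
log1p (suc n) = sgn n * (+ 1 / suc n)

-- Formal composition log(1 + f) for a series f with zero constant term:
-- log(1+f) = Σ_{k≥1} (-1)^{k-1} f^k / k.  Since f^k has order ≥ k, the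
-- coefficient of t^n only receives contributions from k ≤ n.
logOnePlus : PS → PS
-- (summing over k = suc j, j = 0 … n-1)
logOnePlus f n = sumBelow n (λ j → (sgn j * (+ 1 / suc j)) * pow f (suc j) n)

bel : ℕ → ℚ → ℚ
bel n x = fact n * logOnePlus (scale x log1p) n

expm1 : PS
expm1 zero    = 0ℚ
expm1 (suc n) = invFact (suc n)

-- Stirling numbers of the second kind: (e^t-1)^k / k! = Σ_n S2(n,k) t^n/n!
S2 : ℕ → ℕ → ℚ
S2 n k = fact n * (invFact k * pow expm1 k n)

expNeg : PS
expNeg n = sgn n * invFact n

geom : PS
geom n = 1ℚ

-- Derangement numbers: e^{-t}/(1-t) = Σ_n d_n t^n/n!
der : ℕ → ℚ
der n = fact n * (expNeg ⊛ geom) n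

{-# OPTIONS --safe #-}
module Submission where

-- Extracting the coefficient of t^{k+1} in log(1 - log(1+t)) gives
-- bel_{k+1}(-1) = -Σ_j j! S₁(k+1, j+1), so the left-hand side is
-- -Σ_j j! Σ_k S₂(n,k) S₁(k+1, j+1).  By the recurrences of S₁ and S₂ the inner sum
-- satisfies a signed Pascal recurrence, which identifies it as (-1)^{n-j} C(n,j); and
-- Σ_j (-1)^{n-j} n!/(n-j)! = d_n.  The two Stirling recurrences are read off from the
-- differential equations (1+t) ((log(1+t))^{j+1})' = (j+1) (log(1+t))^j and
-- ((e^t-1)^{k+1})' = (k+1) ((e^t-1)^{k+1} + (e^t-1)^k).

open import Defs
open import Data.Nat as ℕ using (ℕ; zero; suc; _!; _∸_; _≤_; _<_; _≤′_; ≤′-refl; ≤′-step; s≤s)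
import Data.Nat.Properties as ℕP
open import Data.Nat.Properties using (_!≢0)
import Data.Integer as ℤ
import Data.Integer.Properties as ℤP
open import Data.Rational using (ℚ; _+_; _*_; -_; _-_; 0ℚ; 1ℚ; _/_; toℚᵘ)
open import Data.Rational.Properties using (toℚᵘ-injective; toℚᵘ-homo-+; toℚᵘ-homo-*; toℚᵘ-fromℚᵘ)
import Data.Rational.Unnormalised as ℚᵘ
import Data.Rational.Unnormalised.Properties as ℚᵘP
open import Data.Rational.Solver using (module +-*-Solver)
open +-*-Solver
open import Function using (_∘_)
open import Relation.Binary.PropositionalEquality
open ≡-Reasoning

fromℕ : ℕ → ℚ
fromℕ n = ℤ.+ n / 1

private
  toℚᵘ-/ : ∀ i n .{{_ : ℕ.NonZero n}} → toℚᵘ (i / n) ℚᵘ.≃ (i ℚᵘ./ n)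
  toℚᵘ-/ i (suc m) = toℚᵘ-fromℚᵘ (ℚᵘ.mkℚᵘ i m)

  toℚᵘ-fromℕ : ∀ n → toℚᵘ (fromℕ n) ℚᵘ.≃ (ℤ.+ n ℚᵘ./ 1)
  toℚᵘ-fromℕ n = toℚᵘ-/ (ℤ.+ n) 1

fromℕ-+ : ∀ m n → fromℕ (m ℕ.+ n) ≡ fromℕ m + fromℕ n
fromℕ-+ m n = toℚᵘ-injective (ℚᵘP.≃-trans (toℚᵘ-fromℕ (m ℕ.+ n)) (ℚᵘP.≃-sym
  (ℚᵘP.≃-trans (toℚᵘ-homo-+ (fromℕ m) (fromℕ n))
  (ℚᵘP.≃-trans (ℚᵘP.+-cong (toℚᵘ-fromℕ m) (toℚᵘ-fromℕ n))
  (ℚᵘ.*≡* (trans (ℤP.*-identityʳ _)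
          (trans (cong₂ ℤ._+_ (ℤP.*-identityʳ (ℤ.+ m)) (ℤP.*-identityʳ (ℤ.+ n)))
                 (sym (ℤP.*-identityʳ _)))))))))

fromℕ-* : ∀ m n → fromℕ (m ℕ.* n) ≡ fromℕ m * fromℕ n
fromℕ-* m n = toℚᵘ-injective (ℚᵘP.≃-trans (toℚᵘ-fromℕ (m ℕ.* n)) (ℚᵘP.≃-sym
  (ℚᵘP.≃-trans (toℚᵘ-homo-* (fromℕ m) (fromℕ n))
  (ℚᵘP.≃-trans (ℚᵘP.*-cong (toℚᵘ-fromℕ m) (toℚᵘ-fromℕ n))
  (ℚᵘ.*≡* (trans (ℤP.*-identityʳ _) (trans (sym (ℤP.pos-* m n)) (sym (ℤP.*-identityʳ _)))))))))

fromℕ*1/n : ∀ n .{{_ : ℕ.NonZero n}} → fromℕ n * (ℤ.+ 1 / n) ≡ 1ℚ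
fromℕ*1/n n@(suc _) = toℚᵘ-injective (ℚᵘP.≃-trans (toℚᵘ-homo-* (fromℕ n) (ℤ.+ 1 / n))
  (ℚᵘP.≃-trans (ℚᵘP.*-cong (toℚᵘ-fromℕ n) (toℚᵘ-/ (ℤ.+ 1) n))
  (ℚᵘ.*≡* (trans (ℤP.*-identityʳ _) (trans (ℤP.*-identityʳ _)
          (sym (trans (ℤP.*-identityˡ _) (cong ℤ.+_ (ℕP.*-identityˡ n)))))))))

fromℕ-suc : ∀ n → fromℕ (suc n) ≡ 1ℚ + fromℕ n
fromℕ-suc = fromℕ-+ 1

fact-suc : ∀ n → fact (suc n) ≡ fromℕ (suc n) * fact n
fact-suc n = fromℕ-* (suc n) (n !)

fact*invFact : ∀ n → fact n * invFact n ≡ 1ℚ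
fact*invFact n = fromℕ*1/n (n !) {{n !≢0}}

invFact-suc : ∀ n → invFact n ≡ fromℕ (suc n) * invFact (suc n)
invFact-suc n = begin
  invFact n                                                    ≡⟨ solve 1 (λ a → a := a :* con 1ℚ) refl (invFact n) ⟩
  invFact n * 1ℚ                                               ≡⟨ cong (invFact n *_) (sym (fact*invFact (suc n))) ⟩
  invFact n * (fact (suc n) * invFact (suc n))                 ≡⟨ cong (λ z → invFact n * (z * invFact (suc n))) (fact-suc n) ⟩
  invFact n * ((fromℕ (suc n) * fact n) * invFact (suc n))     ≡⟨ solve 4 (λ a b c d → a :* ((b :* c) :* d) := (b :* d) :* (c :* a)) refl (invFact n) (fromℕ (suc n)) (fact n) (invFact (suc n)) ⟩
  (fromℕ (suc n) * invFact (suc n)) * (fact n * invFact n)     ≡⟨ cong ((fromℕ (suc n) * invFact (suc n)) *_) (fact*invFact n) ⟩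
  (fromℕ (suc n) * invFact (suc n)) * 1ℚ                       ≡⟨ solve 1 (λ a → a :* con 1ℚ := a) refl _ ⟩
  fromℕ (suc n) * invFact (suc n)                              ∎

invFact-suc*fact : ∀ n → invFact (suc n) * fact n ≡ ℤ.+ 1 / suc n
invFact-suc*fact n = begin
  invFact (suc n) * fact n                                      ≡⟨ solve 2 (λ a b → a :* b := (a :* b) :* con 1ℚ) refl (invFact (suc n)) (fact n) ⟩
  (invFact (suc n) * fact n) * 1ℚ                               ≡⟨ cong ((invFact (suc n) * fact n) *_) (sym (fromℕ*1/n (suc n))) ⟩
  (invFact (suc n) * fact n) * (fromℕ (suc n) * (ℤ.+ 1 / suc n))  ≡⟨ solve 4 (λ a b c d → (a :* b) :* (c :* d) := (b :* (c :* a)) :* d) refl (invFact (suc n)) (fact n) (fromℕ (suc n)) (ℤ.+ 1 / suc n) ⟩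
  (fact n * (fromℕ (suc n) * invFact (suc n))) * (ℤ.+ 1 / suc n)  ≡⟨ cong (λ z → (fact n * z) * (ℤ.+ 1 / suc n)) (sym (invFact-suc n)) ⟩
  (fact n * invFact n) * (ℤ.+ 1 / suc n)                          ≡⟨ cong (_* (ℤ.+ 1 / suc n)) (fact*invFact n) ⟩
  1ℚ * (ℤ.+ 1 / suc n)                                            ≡⟨ solve 1 (λ a → con 1ℚ :* a := a) refl _ ⟩
  ℤ.+ 1 / suc n                                                 ∎

sgn*sgn : ∀ n → sgn n * sgn n ≡ 1ℚ
sgn*sgn zero    = refl
sgn*sgn (suc n) = trans (solve 1 (λ a → (:- a) :* (:- a) := a :* a) refl (sgn n)) (sgn*sgn n)

sumTo-cong≤ : ∀ n {f g : ℕ → ℚ} → (∀ i → i ≤ n → f i ≡ g i) → sumTo n f ≡ sumTo n g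
sumTo-cong≤ zero    f≡g = f≡g 0 ℕ.z≤n
sumTo-cong≤ (suc n) f≡g = cong₂ _+_ (sumTo-cong≤ n (λ i i≤n → f≡g i (ℕP.m≤n⇒m≤1+n i≤n))) (f≡g (suc n) ℕP.≤-refl)

sumTo-cong : ∀ n {f g : ℕ → ℚ} → f ≗ g → sumTo n f ≡ sumTo n g
sumTo-cong n f≗g = sumTo-cong≤ n (λ i _ → f≗g i)

sumTo-zero : ∀ n (f : ℕ → ℚ) → (∀ i → i ≤ n → f i ≡ 0ℚ) → sumTo n f ≡ 0ℚ
sumTo-zero n f f≡0 = trans (sumTo-cong≤ n f≡0) (sumTo-const0 n)
  where
  sumTo-const0 : ∀ n → sumTo n (λ _ → 0ℚ) ≡ 0ℚ
  sumTo-const0 zero    = refl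
  sumTo-const0 (suc n) = cong (_+ 0ℚ) (sumTo-const0 n)

sumTo-+ : ∀ n (f g : ℕ → ℚ) → sumTo n (λ i → f i + g i) ≡ sumTo n f + sumTo n g
sumTo-+ zero    f g = refl
sumTo-+ (suc n) f g = begin
  sumTo n (λ i → f i + g i) + (f (suc n) + g (suc n))  ≡⟨ cong (_+ (f (suc n) + g (suc n))) (sumTo-+ n f g) ⟩
  (sumTo n f + sumTo n g) + (f (suc n) + g (suc n))    ≡⟨ solve 4 (λ a b c d → (a :+ b) :+ (c :+ d) := (a :+ c) :+ (b :+ d)) refl (sumTo n f) (sumTo n g) (f (suc n)) (g (suc n)) ⟩
  (sumTo n f + f (suc n)) + (sumTo n g + g (suc n))    ∎

*-distribˡ-sumTo : ∀ n c (f : ℕ → ℚ) → c * sumTo n f ≡ sumTo n (λ i → c * f i)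
*-distribˡ-sumTo zero    c f = refl
*-distribˡ-sumTo (suc n) c f =
  trans (solve 3 (λ c a b → c :* (a :+ b) := c :* a :+ c :* b) refl c (sumTo n f) (f (suc n)))
        (cong (_+ c * f (suc n)) (*-distribˡ-sumTo n c f))

neg-distrib-sumTo : ∀ n (f : ℕ → ℚ) → - sumTo n f ≡ sumTo n (λ i → - f i)
neg-distrib-sumTo zero    f = refl
neg-distrib-sumTo (suc n) f =
  trans (solve 2 (λ a b → :- (a :+ b) := (:- a) :+ (:- b)) refl (sumTo n f) (f (suc n)))
        (cong (_+ - f (suc n)) (neg-distrib-sumTo n f))

sumTo-sucˡ : ∀ n (f : ℕ → ℚ) → sumTo (suc n) f ≡ f 0 + sumTo n (λ i → f (suc i))
sumTo-sucˡ zero    f = refl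
sumTo-sucˡ (suc n) f =
  trans (cong (_+ f (suc (suc n))) (sumTo-sucˡ n f))
        (solve 3 (λ a b c → (a :+ b) :+ c := a :+ (b :+ c)) refl (f 0) (sumTo n (λ i → f (suc i))) (f (suc (suc n))))

sumTo-reverse : ∀ n (f : ℕ → ℚ) → sumTo n (λ i → f (n ∸ i)) ≡ sumTo n f
sumTo-reverse zero    f = refl
sumTo-reverse (suc n) f = begin
  sumTo (suc n) (λ i → f (suc n ∸ i))  ≡⟨ sumTo-sucˡ n (λ i → f (suc n ∸ i)) ⟩
  f (suc n) + sumTo n (λ i → f (n ∸ i)) ≡⟨ cong (f (suc n) +_) (sumTo-reverse n f) ⟩
  f (suc n) + sumTo n f                 ≡⟨ solve 2 (λ a b → a :+ b := b :+ a) refl (f (suc n)) (sumTo n f) ⟩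
  sumTo (suc n) f                       ∎

sumTo-swap : ∀ m n (f : ℕ → ℕ → ℚ) →
             sumTo m (λ i → sumTo n (λ j → f i j)) ≡ sumTo n (λ j → sumTo m (λ i → f i j))
sumTo-swap zero    n f = refl
sumTo-swap (suc m) n f =
  trans (cong (_+ sumTo n (f (suc m))) (sumTo-swap m n f)) (sym (sumTo-+ n _ _))

sumBelow-suc : ∀ n (f : ℕ → ℚ) → sumBelow (suc n) f ≡ sumTo n f
sumBelow-suc zero    f = solve 1 (λ a → con 0ℚ :+ a := a) refl (f 0)
sumBelow-suc (suc n) f = cong (_+ f (suc n)) (sumBelow-suc n f)

sumTo-extend : ∀ {m n} (f : ℕ → ℚ) → m ≤′ n → (∀ i → m < i → f i ≡ 0ℚ) → sumTo m f ≡ sumTo n f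
sumTo-extend f ≤′-refl f≡0 = refl
sumTo-extend {m} f (≤′-step {n} m≤′n) f≡0 = begin
  sumTo m f          ≡⟨ sumTo-extend f m≤′n f≡0 ⟩
  sumTo n f          ≡⟨ solve 1 (λ a → a := a :+ con 0ℚ) refl (sumTo n f) ⟩
  sumTo n f + 0ℚ     ≡⟨ cong (sumTo n f +_) (sym (f≡0 (suc n) (s≤s (ℕP.≤′⇒≤ m≤′n)))) ⟩
  sumTo (suc n) f    ∎

-- Formal power series

infixl 6 _⊕_

_⊕_ : PS → PS → PS
(f ⊕ g) n = f n + g n

0ₚ : PS
0ₚ _ = 0ℚ

1ₚ : PS
1ₚ zero    = 1ℚ
1ₚ (suc _) = 0ℚ

⊛-congˡ : ∀ {f f′ : PS} (g : PS) → f ≗ f′ → f ⊛ g ≗ f′ ⊛ g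
⊛-congˡ g f≗f′ n = sumTo-cong n (λ i → cong (_* g (n ∸ i)) (f≗f′ i))

⊛-congʳ : ∀ (f : PS) {g g′ : PS} → g ≗ g′ → f ⊛ g ≗ f ⊛ g′
⊛-congʳ f g≗g′ n = sumTo-cong n (λ i → cong (f i *_) (g≗g′ (n ∸ i)))

⊛-identityˡ : ∀ g → 1ₚ ⊛ g ≗ g
⊛-identityˡ g zero    = solve 1 (λ a → con 1ℚ :* a := a) refl (g 0)
⊛-identityˡ g (suc n) = begin
  (1ₚ ⊛ g) (suc n)                                 ≡⟨ sumTo-sucˡ n _ ⟩
  1ℚ * g (suc n) + sumTo n (λ i → 0ℚ * g (n ∸ i))  ≡⟨ cong (1ℚ * g (suc n) +_) (sumTo-zero n _ (λ i _ → solve 1 (λ a → con 0ℚ :* a := con 0ℚ) refl (g (n ∸ i)))) ⟩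
  1ℚ * g (suc n) + 0ℚ                              ≡⟨ solve 1 (λ a → con 1ℚ :* a :+ con 0ℚ := a) refl (g (suc n)) ⟩
  g (suc n)                                        ∎

⊛-zeroʳ : ∀ f → f ⊛ 0ₚ ≗ 0ₚ
⊛-zeroʳ f n = sumTo-zero n _ (λ i _ → solve 1 (λ a → a :* con 0ℚ := con 0ℚ) refl (f i))

⊛-distribˡ-⊕ : ∀ f g h → f ⊛ (g ⊕ h) ≗ f ⊛ g ⊕ f ⊛ h
⊛-distribˡ-⊕ f g h n = trans
  (sumTo-cong n (λ i → solve 3 (λ a b c → a :* (b :+ c) := a :* b :+ a :* c) refl (f i) (g (n ∸ i)) (h (n ∸ i))))
  (sumTo-+ n _ _)

⊛-distribʳ-⊕ : ∀ f g h → (f ⊕ g) ⊛ h ≗ f ⊛ h ⊕ g ⊛ h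
⊛-distribʳ-⊕ f g h n = trans
  (sumTo-cong n (λ i → solve 3 (λ a b c → (a :+ b) :* c := a :* c :+ b :* c) refl (f i) (g i) (h (n ∸ i))))
  (sumTo-+ n _ _)

⊛-scaleˡ : ∀ c f g → scale c f ⊛ g ≗ scale c (f ⊛ g)
⊛-scaleˡ c f g n = trans
  (sumTo-cong n (λ i → solve 3 (λ c a b → (c :* a) :* b := c :* (a :* b)) refl c (f i) (g (n ∸ i))))
  (sym (*-distribˡ-sumTo n c _))

⊛-scaleʳ : ∀ c f g → f ⊛ scale c g ≗ scale c (f ⊛ g)
⊛-scaleʳ c f g n = trans
  (sumTo-cong n (λ i → solve 3 (λ c a b → a :* (c :* b) := c :* (a :* b)) refl c (f i) (g (n ∸ i))))
  (sym (*-distribˡ-sumTo n c _))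

pow-vanish : ∀ f → f 0 ≡ 0ℚ → ∀ k n → n < k → pow f k n ≡ 0ℚ
pow-vanish f f0≡0 (suc k) n (s≤s n≤k) = sumTo-zero n _ term
  where
  term : ∀ i → i ≤ n → f i * pow f k (n ∸ i) ≡ 0ℚ
  term zero    _         = trans (cong (_* pow f k n) f0≡0) (solve 1 (λ a → con 0ℚ :* a := con 0ℚ) refl (pow f k n))
  term (suc i) i<n = trans
    (cong (f (suc i) *_) (pow-vanish f f0≡0 k (n ∸ suc i) (ℕP.<-≤-trans (ℕP.∸-monoʳ-< (s≤s ℕ.z≤n) i<n) n≤k)))
    (solve 1 (λ a → a :* con 0ℚ := con 0ℚ) refl (f (suc i)))

pow-neg : ∀ f k → pow (scale (- 1ℚ) f) k ≗ scale (sgn k) (pow f k)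
pow-neg f zero    zero    = refl
pow-neg f zero    (suc n) = refl
pow-neg f (suc k) n = begin
  (scale (- 1ℚ) f ⊛ pow (scale (- 1ℚ) f) k) n  ≡⟨ ⊛-congʳ (scale (- 1ℚ) f) (pow-neg f k) n ⟩
  (scale (- 1ℚ) f ⊛ scale (sgn k) (pow f k)) n ≡⟨ ⊛-scaleˡ (- 1ℚ) f (scale (sgn k) (pow f k)) n ⟩
  - 1ℚ * (f ⊛ scale (sgn k) (pow f k)) n       ≡⟨ cong (- 1ℚ *_) (⊛-scaleʳ (sgn k) f (pow f k) n) ⟩
  - 1ℚ * (sgn k * pow f (suc k) n)             ≡⟨ solve 2 (λ a b → (:- con 1ℚ) :* (a :* b) := (:- a) :* b) refl (sgn k) (pow f (suc k) n) ⟩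
  (- sgn k) * pow f (suc k) n                  ∎

-- Derivative and multiplication by 1+t

∂ : PS → PS
∂ f n = fromℕ (suc n) * f (suc n)

[1+t]*_ : PS → PS
([1+t]* f) zero    = f zero
([1+t]* f) (suc n) = f (suc n) + f n

[1+t]*-cong : ∀ {f g : PS} → f ≗ g → [1+t]* f ≗ [1+t]* g
[1+t]*-cong f≗g zero    = f≗g zero
[1+t]*-cong f≗g (suc n) = cong₂ _+_ (f≗g (suc n)) (f≗g n)

[1+t]*-⊕ : ∀ f g → [1+t]* (f ⊕ g) ≗ [1+t]* f ⊕ [1+t]* g
[1+t]*-⊕ f g zero    = refl
[1+t]*-⊕ f g (suc n) = solve 4 (λ a b c d → (a :+ b) :+ (c :+ d) := (a :+ c) :+ (b :+ d)) refl (f (suc n)) (g (suc n)) (f n) (g n)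

[1+t]*-⊛ˡ : ∀ f g → [1+t]* (f ⊛ g) ≗ ([1+t]* f) ⊛ g
[1+t]*-⊛ˡ f g zero    = refl
[1+t]*-⊛ˡ f g (suc n) = sym (begin
  (([1+t]* f) ⊛ g) (suc n)
    ≡⟨ sumTo-sucˡ n _ ⟩
  f 0 * g (suc n) + sumTo n (λ i → (f (suc i) + f i) * g (n ∸ i))
    ≡⟨ cong (f 0 * g (suc n) +_) (trans (sumTo-cong n (λ i → solve 3 (λ a b c → (a :+ b) :* c := a :* c :+ b :* c) refl (f (suc i)) (f i) (g (n ∸ i)))) (sumTo-+ n _ _)) ⟩
  f 0 * g (suc n) + (sumTo n (λ i → f (suc i) * g (n ∸ i)) + (f ⊛ g) n)
    ≡⟨ solve 3 (λ a b c → a :+ (b :+ c) := (a :+ b) :+ c) refl (f 0 * g (suc n)) (sumTo n (λ i → f (suc i) * g (n ∸ i))) ((f ⊛ g) n) ⟩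
  (f 0 * g (suc n) + sumTo n (λ i → f (suc i) * g (n ∸ i))) + (f ⊛ g) n
    ≡⟨ cong (_+ (f ⊛ g) n) (sym (sumTo-sucˡ n (λ i → f i * g (suc n ∸ i)))) ⟩
  (f ⊛ g) (suc n) + (f ⊛ g) n
    ∎)

[1+t]*-⊛ʳ : ∀ f g → [1+t]* (f ⊛ g) ≗ f ⊛ ([1+t]* g)
[1+t]*-⊛ʳ f g zero    = refl
[1+t]*-⊛ʳ f g (suc n) = sym (begin
  sumTo n (λ i → f i * ([1+t]* g) (suc n ∸ i)) + f (suc n) * ([1+t]* g) (n ∸ n)
    ≡⟨ cong (λ z → sumTo n (λ i → f i * ([1+t]* g) (suc n ∸ i)) + f (suc n) * ([1+t]* g) z) (ℕP.n∸n≡0 n) ⟩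
  sumTo n (λ i → f i * ([1+t]* g) (suc n ∸ i)) + f (suc n) * g 0
    ≡⟨ cong (_+ f (suc n) * g 0) (trans (sumTo-cong≤ n split) (sumTo-+ n _ _)) ⟩
  (sumTo n (λ i → f i * g (suc n ∸ i)) + (f ⊛ g) n) + f (suc n) * g 0
    ≡⟨ solve 3 (λ a b c → (a :+ b) :+ c := (a :+ c) :+ b) refl (sumTo n (λ i → f i * g (suc n ∸ i))) ((f ⊛ g) n) (f (suc n) * g 0) ⟩
  (sumTo n (λ i → f i * g (suc n ∸ i)) + f (suc n) * g 0) + (f ⊛ g) n
    ≡⟨ cong (λ z → (sumTo n (λ i → f i * g (suc n ∸ i)) + f (suc n) * g z) + (f ⊛ g) n) (sym (ℕP.n∸n≡0 n)) ⟩
  (f ⊛ g) (suc n) + (f ⊛ g) n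
    ∎)
  where
  split : ∀ i → i ≤ n → f i * ([1+t]* g) (suc n ∸ i) ≡ f i * g (suc n ∸ i) + f i * g (n ∸ i)
  split i i≤n rewrite ℕP.+-∸-assoc 1 i≤n =
    solve 3 (λ a b c → a :* (b :+ c) := a :* b :+ a :* c) refl (f i) (g (suc (n ∸ i))) (g (n ∸ i))

∂-⊛ : ∀ f g → ∂ (f ⊛ g) ≗ ∂ f ⊛ g ⊕ f ⊛ ∂ g
∂-⊛ f g n = begin
  fromℕ (suc n) * sumTo (suc n) (λ i → f i * g (suc n ∸ i))
    ≡⟨ *-distribˡ-sumTo (suc n) (fromℕ (suc n)) _ ⟩
  sumTo (suc n) (λ i → fromℕ (suc n) * (f i * g (suc n ∸ i)))
    ≡⟨ sumTo-cong≤ (suc n) split ⟩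
  sumTo (suc n) (λ i → fromℕ i * f i * g (suc n ∸ i) + f i * (fromℕ (suc n ∸ i) * g (suc n ∸ i)))
    ≡⟨ sumTo-+ (suc n) _ _ ⟩
  sumTo (suc n) (λ i → fromℕ i * f i * g (suc n ∸ i)) + sumTo (suc n) (λ i → f i * (fromℕ (suc n ∸ i) * g (suc n ∸ i)))
    ≡⟨ cong₂ _+_ ∂f⊛g f⊛∂g ⟩
  (∂ f ⊛ g) n + (f ⊛ ∂ g) n
    ∎
  where
  split : ∀ i → i ≤ suc n → fromℕ (suc n) * (f i * g (suc n ∸ i)) ≡ fromℕ i * f i * g (suc n ∸ i) + f i * (fromℕ (suc n ∸ i) * g (suc n ∸ i))
  split i i≤ = begin
    fromℕ (suc n) * (f i * g (suc n ∸ i))                 ≡⟨ cong (λ z → fromℕ z * (f i * g (suc n ∸ i))) (sym (ℕP.m+[n∸m]≡n i≤)) ⟩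
    fromℕ (i ℕ.+ (suc n ∸ i)) * (f i * g (suc n ∸ i))     ≡⟨ cong (_* (f i * g (suc n ∸ i))) (fromℕ-+ i (suc n ∸ i)) ⟩
    (fromℕ i + fromℕ (suc n ∸ i)) * (f i * g (suc n ∸ i)) ≡⟨ solve 4 (λ a b c d → (a :+ b) :* (c :* d) := a :* c :* d :+ c :* (b :* d)) refl (fromℕ i) (fromℕ (suc n ∸ i)) (f i) (g (suc n ∸ i)) ⟩
    fromℕ i * f i * g (suc n ∸ i) + f i * (fromℕ (suc n ∸ i) * g (suc n ∸ i)) ∎
  ∂f⊛g : sumTo (suc n) (λ i → fromℕ i * f i * g (suc n ∸ i)) ≡ (∂ f ⊛ g) n
  ∂f⊛g = begin
    sumTo (suc n) (λ i → fromℕ i * f i * g (suc n ∸ i))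
      ≡⟨ sumTo-sucˡ n _ ⟩
    fromℕ 0 * f 0 * g (suc n) + sumTo n (λ i → fromℕ (suc i) * f (suc i) * g (n ∸ i))
      ≡⟨ solve 3 (λ a b c → con 0ℚ :* a :* b :+ c := c) refl (f 0) (g (suc n)) _ ⟩
    sumTo n (λ i → fromℕ (suc i) * f (suc i) * g (n ∸ i))
      ∎
  f⊛∂g : sumTo (suc n) (λ i → f i * (fromℕ (suc n ∸ i) * g (suc n ∸ i))) ≡ (f ⊛ ∂ g) n
  f⊛∂g = begin
    sumTo n (λ i → f i * (fromℕ (suc n ∸ i) * g (suc n ∸ i))) + f (suc n) * (fromℕ (n ∸ n) * g (n ∸ n))
      ≡⟨ cong (λ z → sumTo n (λ i → f i * (fromℕ (suc n ∸ i) * g (suc n ∸ i))) + f (suc n) * (fromℕ z * g z)) (ℕP.n∸n≡0 n) ⟩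
    sumTo n (λ i → f i * (fromℕ (suc n ∸ i) * g (suc n ∸ i))) + f (suc n) * (fromℕ 0 * g 0)
      ≡⟨ solve 3 (λ a b c → a :+ b :* (con 0ℚ :* c) := a) refl _ (f (suc n)) (g 0) ⟩
    sumTo n (λ i → f i * (fromℕ (suc n ∸ i) * g (suc n ∸ i)))
      ≡⟨ sumTo-cong≤ n (λ i i≤n → cong (λ z → f i * (fromℕ z * g z)) (ℕP.+-∸-assoc 1 i≤n)) ⟩
    (f ⊛ ∂ g) n
      ∎

∂-pow-zero : ∀ f → ∂ (pow f 0) ≗ 0ₚ
∂-pow-zero f n = solve 1 (λ a → a :* con 0ℚ := con 0ℚ) refl (fromℕ (suc n))

[1+t]*∂-pow-zero : ∀ f → [1+t]* ∂ (pow f 0) ≗ 0ₚ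
[1+t]*∂-pow-zero f zero    = ∂-pow-zero f 0
[1+t]*∂-pow-zero f (suc n) = cong₂ _+_ (∂-pow-zero f (suc n)) (∂-pow-zero f n)

∂log1p : ∂ log1p ≗ sgn
∂log1p n = begin
  fromℕ (suc n) * (sgn n * (ℤ.+ 1 / suc n)) ≡⟨ solve 3 (λ a b c → a :* (b :* c) := b :* (a :* c)) refl (fromℕ (suc n)) (sgn n) (ℤ.+ 1 / suc n) ⟩
  sgn n * (fromℕ (suc n) * (ℤ.+ 1 / suc n)) ≡⟨ cong (sgn n *_) (fromℕ*1/n (suc n)) ⟩
  sgn n * 1ℚ                                 ≡⟨ solve 1 (λ a → a :* con 1ℚ := a) refl (sgn n) ⟩
  sgn n                                      ∎

[1+t]*∂log1p : [1+t]* ∂ log1p ≗ 1ₚ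
[1+t]*∂log1p zero    = ∂log1p 0
[1+t]*∂log1p (suc n) = trans (cong₂ _+_ (∂log1p (suc n)) (∂log1p n)) (solve 1 (λ a → (:- a) :+ a := con 0ℚ) refl (sgn n))

∂expm1 : ∂ expm1 ≗ 1ₚ ⊕ expm1
∂expm1 zero    = sym (invFact-suc 0)
∂expm1 (suc n) = trans (sym (invFact-suc (suc n))) (solve 1 (λ a → a := con 0ℚ :+ a) refl (invFact (suc n)))

[1+t]*∂-log1p⊛ : ∀ g → [1+t]* ∂ (log1p ⊛ g) ≗ g ⊕ log1p ⊛ ([1+t]* ∂ g)
[1+t]*∂-log1p⊛ g n = begin
  ([1+t]* ∂ (log1p ⊛ g)) n                               ≡⟨ [1+t]*-cong (∂-⊛ log1p g) n ⟩
  ([1+t]* (∂ log1p ⊛ g ⊕ log1p ⊛ ∂ g)) n                 ≡⟨ [1+t]*-⊕ (∂ log1p ⊛ g) (log1p ⊛ ∂ g) n ⟩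
  ([1+t]* (∂ log1p ⊛ g)) n + ([1+t]* (log1p ⊛ ∂ g)) n    ≡⟨ cong₂ _+_ ([1+t]*-⊛ˡ (∂ log1p) g n) ([1+t]*-⊛ʳ log1p (∂ g) n) ⟩
  (([1+t]* ∂ log1p) ⊛ g) n + (log1p ⊛ ([1+t]* ∂ g)) n    ≡⟨ cong (_+ (log1p ⊛ ([1+t]* ∂ g)) n) (trans (⊛-congˡ g [1+t]*∂log1p n) (⊛-identityˡ g n)) ⟩
  g n + (log1p ⊛ ([1+t]* ∂ g)) n                         ∎

∂-expm1⊛ : ∀ g → ∂ (expm1 ⊛ g) ≗ g ⊕ expm1 ⊛ g ⊕ expm1 ⊛ ∂ g
∂-expm1⊛ g n = begin
  ∂ (expm1 ⊛ g) n                                        ≡⟨ ∂-⊛ expm1 g n ⟩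
  (∂ expm1 ⊛ g) n + (expm1 ⊛ ∂ g) n                      ≡⟨ cong (_+ (expm1 ⊛ ∂ g) n) (⊛-congˡ g ∂expm1 n) ⟩
  ((1ₚ ⊕ expm1) ⊛ g) n + (expm1 ⊛ ∂ g) n                 ≡⟨ cong (_+ (expm1 ⊛ ∂ g) n) (⊛-distribʳ-⊕ 1ₚ expm1 g n) ⟩
  ((1ₚ ⊛ g) n + (expm1 ⊛ g) n) + (expm1 ⊛ ∂ g) n         ≡⟨ cong (λ z → (z + (expm1 ⊛ g) n) + (expm1 ⊛ ∂ g) n) (⊛-identityˡ g n) ⟩
  (g n + (expm1 ⊛ g) n) + (expm1 ⊛ ∂ g) n                ∎

pow-log1p-ode : ∀ j → [1+t]* ∂ (pow log1p (suc j)) ≗ scale (fromℕ (suc j)) (pow log1p j)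
pow-log1p-ode zero n = begin
  ([1+t]* ∂ (log1p ⊛ L₀)) n               ≡⟨ [1+t]*∂-log1p⊛ L₀ n ⟩
  L₀ n + (log1p ⊛ ([1+t]* ∂ L₀)) n        ≡⟨ cong (L₀ n +_) (trans (⊛-congʳ log1p ([1+t]*∂-pow-zero log1p) n) (⊛-zeroʳ log1p n)) ⟩
  L₀ n + 0ℚ                               ≡⟨ solve 1 (λ a → a :+ con 0ℚ := con 1ℚ :* a) refl (L₀ n) ⟩
  fromℕ 1 * L₀ n                          ∎
  where L₀ = pow log1p 0
pow-log1p-ode (suc j) n = begin
  ([1+t]* ∂ (log1p ⊛ L)) n                ≡⟨ [1+t]*∂-log1p⊛ L n ⟩
  L n + (log1p ⊛ ([1+t]* ∂ L)) n          ≡⟨ cong (L n +_) (trans (⊛-congʳ log1p (pow-log1p-ode j) n) (⊛-scaleʳ (fromℕ (suc j)) log1p (pow log1p j) n)) ⟩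
  L n + fromℕ (suc j) * L n               ≡⟨ solve 2 (λ a b → a :+ b :* a := (con 1ℚ :+ b) :* a) refl (L n) (fromℕ (suc j)) ⟩
  (1ℚ + fromℕ (suc j)) * L n              ≡⟨ cong (_* L n) (sym (fromℕ-suc (suc j))) ⟩
  fromℕ (suc (suc j)) * L n               ∎
  where L = pow log1p (suc j)

pow-expm1-ode : ∀ k → ∂ (pow expm1 (suc k)) ≗ scale (fromℕ (suc k)) (pow expm1 (suc k) ⊕ pow expm1 k)
pow-expm1-ode zero n = begin
  ∂ (expm1 ⊛ E₀) n                                   ≡⟨ ∂-expm1⊛ E₀ n ⟩
  (E₀ n + E₁ n) + (expm1 ⊛ ∂ E₀) n                   ≡⟨ cong ((E₀ n + E₁ n) +_) (trans (⊛-congʳ expm1 (∂-pow-zero expm1) n) (⊛-zeroʳ expm1 n)) ⟩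
  (E₀ n + E₁ n) + 0ℚ                                 ≡⟨ solve 2 (λ a b → (a :+ b) :+ con 0ℚ := con 1ℚ :* (b :+ a)) refl (E₀ n) (E₁ n) ⟩
  fromℕ 1 * (E₁ n + E₀ n)                            ∎
  where
  E₀ = pow expm1 0
  E₁ = pow expm1 1
pow-expm1-ode (suc k) n = begin
  ∂ (expm1 ⊛ E) n                                    ≡⟨ ∂-expm1⊛ E n ⟩
  (E n + E′ n) + (expm1 ⊛ ∂ E) n                     ≡⟨ cong ((E n + E′ n) +_) (trans (⊛-congʳ expm1 (pow-expm1-ode k) n) (⊛-scaleʳ c expm1 (E ⊕ pow expm1 k) n)) ⟩
  (E n + E′ n) + c * (expm1 ⊛ (E ⊕ pow expm1 k)) n   ≡⟨ cong (λ z → (E n + E′ n) + c * z) (⊛-distribˡ-⊕ expm1 E (pow expm1 k) n) ⟩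
  (E n + E′ n) + c * (E′ n + E n)                    ≡⟨ solve 3 (λ a b c → (a :+ b) :+ c :* (b :+ a) := (con 1ℚ :+ c) :* (b :+ a)) refl (E n) (E′ n) c ⟩
  (1ℚ + c) * (E′ n + E n)                            ≡⟨ cong (_* (E′ n + E n)) (sym (fromℕ-suc (suc k))) ⟩
  fromℕ (suc (suc k)) * (E′ n + E n)                 ∎
  where
  c  = fromℕ (suc k)
  E  = pow expm1 (suc k)
  E′ = pow expm1 (suc (suc k))

-- Stirling numbers

S1 : ℕ → ℕ → ℚ
S1 m j = fact m * (invFact j * pow log1p j m)

S1-vanish : ∀ m j → m < j → S1 m j ≡ 0ℚ
S1-vanish m j m<j = trans (cong (λ z → fact m * (invFact j * z)) (pow-vanish log1p refl j m m<j))
                          (solve 2 (λ a b → a :* (b :* con 0ℚ) := con 0ℚ) refl (fact m) (invFact j))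

S2-vanish : ∀ n k → n < k → S2 n k ≡ 0ℚ
S2-vanish n k n<k = trans (cong (λ z → fact n * (invFact k * z)) (pow-vanish expm1 refl k n n<k))
                          (solve 2 (λ a b → a :* (b :* con 0ℚ) := con 0ℚ) refl (fact n) (invFact k))

S1-suc-zero : ∀ m → S1 (suc m) 0 ≡ 0ℚ
S1-suc-zero m = solve 1 (λ a → a :* (con 1ℚ :* con 0ℚ) := con 0ℚ) refl (fact (suc m))

S2-suc-zero : ∀ n → S2 (suc n) 0 ≡ 0ℚ
S2-suc-zero n = solve 1 (λ a → a :* (con 1ℚ :* con 0ℚ) := con 0ℚ) refl (fact (suc n))

pow-log1p-ode-coeff : ∀ j m → fromℕ (suc m) * pow log1p (suc j) (suc m) + fromℕ m * pow log1p (suc j) m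
                             ≡ fromℕ (suc j) * pow log1p j m
pow-log1p-ode-coeff j zero    = trans (solve 2 (λ a b → a :+ con 0ℚ :* b := a) refl (fromℕ 1 * pow log1p (suc j) 1) (pow log1p (suc j) 0))
                                      (pow-log1p-ode j 0)
pow-log1p-ode-coeff j (suc m) = pow-log1p-ode j (suc m)

S1-suc-suc : ∀ m j → S1 (suc m) (suc j) ≡ S1 m j - fromℕ m * S1 m (suc j)
S1-suc-suc m j = begin
  fact (suc m) * (invFact (suc j) * L′ (suc m))
    ≡⟨ cong (_* (invFact (suc j) * L′ (suc m))) (fact-suc m) ⟩
  (fromℕ (suc m) * fact m) * (invFact (suc j) * L′ (suc m))
    ≡⟨ solve 4 (λ a b c d → (a :* b) :* (c :* d) := (b :* c) :* (a :* d)) refl (fromℕ (suc m)) (fact m) (invFact (suc j)) (L′ (suc m)) ⟩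
  (fact m * invFact (suc j)) * (fromℕ (suc m) * L′ (suc m))
    ≡⟨ cong ((fact m * invFact (suc j)) *_) coefficient ⟩
  (fact m * invFact (suc j)) * (fromℕ (suc j) * L m - fromℕ m * L′ m)
    ≡⟨ solve 6 (λ f i a b c d → (f :* i) :* (a :* b :- c :* d) := f :* ((a :* i) :* b) :- c :* (f :* (i :* d))) refl (fact m) (invFact (suc j)) (fromℕ (suc j)) (L m) (fromℕ m) (L′ m) ⟩
  fact m * ((fromℕ (suc j) * invFact (suc j)) * L m) - fromℕ m * S1 m (suc j)
    ≡⟨ cong (λ z → fact m * (z * L m) - fromℕ m * S1 m (suc j)) (sym (invFact-suc j)) ⟩
  S1 m j - fromℕ m * S1 m (suc j)
    ∎
  where
  L  = pow log1p j
  L′ = pow log1p (suc j)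
  coefficient : fromℕ (suc m) * L′ (suc m) ≡ fromℕ (suc j) * L m - fromℕ m * L′ m
  coefficient = trans (solve 2 (λ a b → a := (a :+ b) :- b) refl (fromℕ (suc m) * L′ (suc m)) (fromℕ m * L′ m))
                      (cong (_- fromℕ m * L′ m) (pow-log1p-ode-coeff j m))

S2-suc-suc : ∀ n k → S2 (suc n) (suc k) ≡ S2 n k + fromℕ (suc k) * S2 n (suc k)
S2-suc-suc n k = begin
  fact (suc n) * (invFact (suc k) * E′ (suc n))
    ≡⟨ cong (_* (invFact (suc k) * E′ (suc n))) (fact-suc n) ⟩
  (fromℕ (suc n) * fact n) * (invFact (suc k) * E′ (suc n))
    ≡⟨ solve 4 (λ a b c d → (a :* b) :* (c :* d) := (b :* c) :* (a :* d)) refl (fromℕ (suc n)) (fact n) (invFact (suc k)) (E′ (suc n)) ⟩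
  (fact n * invFact (suc k)) * (fromℕ (suc n) * E′ (suc n))
    ≡⟨ cong ((fact n * invFact (suc k)) *_) (pow-expm1-ode k n) ⟩
  (fact n * invFact (suc k)) * (fromℕ (suc k) * (E′ n + E n))
    ≡⟨ solve 5 (λ f i a b c → (f :* i) :* (a :* (b :+ c)) := f :* ((a :* i) :* c) :+ a :* (f :* (i :* b))) refl (fact n) (invFact (suc k)) (fromℕ (suc k)) (E′ n) (E n) ⟩
  fact n * ((fromℕ (suc k) * invFact (suc k)) * E n) + fromℕ (suc k) * S2 n (suc k)
    ≡⟨ cong (λ z → fact n * (z * E n) + fromℕ (suc k) * S2 n (suc k)) (sym (invFact-suc k)) ⟩
  S2 n k + fromℕ (suc k) * S2 n (suc k)
    ∎
  where
  E  = pow expm1 k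
  E′ = pow expm1 (suc k)

bel-at-−1 : ∀ k → bel (suc k) (- 1ℚ) ≡ - sumTo k (λ j → fact j * S1 (suc k) (suc j))
bel-at-−1 k = begin
  fact m * sumBelow m g                          ≡⟨ cong (fact m *_) (sumBelow-suc k g) ⟩
  fact m * sumTo k g                             ≡⟨ *-distribˡ-sumTo k (fact m) g ⟩
  sumTo k (λ j → fact m * g j)                   ≡⟨ sumTo-cong k term ⟩
  sumTo k (λ j → - (fact j * S1 m (suc j)))      ≡⟨ sym (neg-distrib-sumTo k _) ⟩
  - sumTo k (λ j → fact j * S1 m (suc j))        ∎
  where
  m = suc k
  inv : ℕ → ℚ
  inv j = ℤ.+ 1 / suc j
  g : ℕ → ℚ
  g j = (sgn j * inv j) * pow (scale (- 1ℚ) log1p) (suc j) m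
  term : ∀ j → fact m * g j ≡ - (fact j * S1 m (suc j))
  term j = begin
    fact m * ((sgn j * inv j) * pow (scale (- 1ℚ) log1p) (suc j) m)
      ≡⟨ cong (λ z → fact m * ((sgn j * inv j) * z)) (pow-neg log1p (suc j) m) ⟩
    fact m * ((sgn j * inv j) * ((- sgn j) * L m))
      ≡⟨ solve 4 (λ f s i x → f :* ((s :* i) :* ((:- s) :* x)) := :- ((s :* s) :* (f :* i :* x))) refl (fact m) (sgn j) (inv j) (L m) ⟩
    - ((sgn j * sgn j) * (fact m * inv j * L m))
      ≡⟨ cong (λ z → - (z * (fact m * inv j * L m))) (sgn*sgn j) ⟩
    - (1ℚ * (fact m * inv j * L m))
      ≡⟨ cong (λ z → - (1ℚ * (fact m * z * L m))) (sym (invFact-suc*fact j)) ⟩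
    - (1ℚ * (fact m * (invFact (suc j) * fact j) * L m))
      ≡⟨ cong -_ (solve 4 (λ f a b x → con 1ℚ :* (f :* (a :* b) :* x) := b :* (f :* (a :* x))) refl (fact m) (invFact (suc j)) (fact j) (L m)) ⟩
    - (fact j * S1 m (suc j))
      ∎
    where L = pow log1p (suc j)

-- The sums Σ_k S₂(n,k) S₁(k+1,j+1)

mixedStirling : ℕ → ℕ → ℚ
mixedStirling n j = sumTo n (λ k → S2 n k * S1 (suc k) (suc j))

mixedStirling-suc : ∀ n j → mixedStirling (suc n) j ≡ sumTo n (λ k → S2 n k * (S1 (suc k) j - S1 (suc k) (suc j)))
mixedStirling-suc n j = begin
  mixedStirling (suc n) j
    ≡⟨ sumTo-sucˡ n _ ⟩
  S2 (suc n) 0 * S1 1 (suc j) + sumTo n (λ k → S2 (suc n) (suc k) * S1 (suc (suc k)) (suc j))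
    ≡⟨ cong₂ _+_ (cong (_* S1 1 (suc j)) (S2-suc-zero n)) (sumTo-cong n (λ k → cong (_* S1 (suc (suc k)) (suc j)) (S2-suc-suc n k))) ⟩
  0ℚ * S1 1 (suc j) + sumTo n (λ k → (S2 n k + fromℕ (suc k) * S2 n (suc k)) * S1 (suc (suc k)) (suc j))
    ≡⟨ trans (solve 2 (λ a b → con 0ℚ :* a :+ b := b) refl (S1 1 (suc j)) _) (sumTo-cong n distrib) ⟩
  sumTo n (λ k → S2 n k * S1 (suc (suc k)) (suc j) + h (suc k))
    ≡⟨ sumTo-+ n _ _ ⟩
  sumTo n (λ k → S2 n k * S1 (suc (suc k)) (suc j)) + sumTo n (λ k → h (suc k))
    ≡⟨ cong (sumTo n (λ k → S2 n k * S1 (suc (suc k)) (suc j)) +_) shift ⟩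
  sumTo n (λ k → S2 n k * S1 (suc (suc k)) (suc j)) + sumTo n h
    ≡⟨ sym (sumTo-+ n _ _) ⟩
  sumTo n (λ k → S2 n k * S1 (suc (suc k)) (suc j) + h k)
    ≡⟨ sumTo-cong n term ⟩
  sumTo n (λ k → S2 n k * (S1 (suc k) j - S1 (suc k) (suc j)))
    ∎
  where
  h : ℕ → ℚ
  h k = fromℕ k * S2 n k * S1 (suc k) (suc j)
  distrib : ∀ k → (S2 n k + fromℕ (suc k) * S2 n (suc k)) * S1 (suc (suc k)) (suc j) ≡ S2 n k * S1 (suc (suc k)) (suc j) + h (suc k)
  distrib k = solve 4 (λ a b c d → (a :+ b :* c) :* d := a :* d :+ b :* c :* d) refl (S2 n k) (fromℕ (suc k)) (S2 n (suc k)) (S1 (suc (suc k)) (suc j))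
  -- h 0 = 0 through the factor fromℕ 0, and h (suc n) = 0 through S2 n (suc n)
  shift : sumTo n (λ k → h (suc k)) ≡ sumTo n h
  shift = begin
    sumTo n (λ k → h (suc k))        ≡⟨ solve 3 (λ a b c → a := con 0ℚ :* b :* c :+ a) refl _ (S2 n 0) (S1 1 (suc j)) ⟩
    h 0 + sumTo n (λ k → h (suc k))  ≡⟨ sym (sumTo-sucˡ n h) ⟩
    sumTo n h + h (suc n)            ≡⟨ cong (λ z → sumTo n h + fromℕ (suc n) * z * S1 (suc (suc n)) (suc j)) (S2-vanish n (suc n) ℕP.≤-refl) ⟩
    sumTo n h + fromℕ (suc n) * 0ℚ * S1 (suc (suc n)) (suc j)
                                     ≡⟨ solve 3 (λ a b c → a :+ b :* con 0ℚ :* c := a) refl (sumTo n h) (fromℕ (suc n)) (S1 (suc (suc n)) (suc j)) ⟩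
    sumTo n h                        ∎
  term : ∀ k → S2 n k * S1 (suc (suc k)) (suc j) + h k ≡ S2 n k * (S1 (suc k) j - S1 (suc k) (suc j))
  term k = begin
    S2 n k * S1 (suc (suc k)) (suc j) + h k
      ≡⟨ cong (λ z → S2 n k * z + h k) (S1-suc-suc (suc k) j) ⟩
    S2 n k * (S1 (suc k) j - fromℕ (suc k) * S1 (suc k) (suc j)) + h k
      ≡⟨ cong (λ z → S2 n k * (S1 (suc k) j - z * S1 (suc k) (suc j)) + h k) (fromℕ-suc k) ⟩
    S2 n k * (S1 (suc k) j - (1ℚ + fromℕ k) * S1 (suc k) (suc j)) + fromℕ k * S2 n k * S1 (suc k) (suc j)
      ≡⟨ solve 4 (λ s a b c → s :* (a :- (con 1ℚ :+ c) :* b) :+ c :* s :* b := s :* (a :- b)) refl (S2 n k) (S1 (suc k) j) (S1 (suc k) (suc j)) (fromℕ k) ⟩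
    S2 n k * (S1 (suc k) j - S1 (suc k) (suc j))
      ∎

mixedStirling-suc-zero : ∀ n → mixedStirling (suc n) 0 ≡ - mixedStirling n 0
mixedStirling-suc-zero n = trans (mixedStirling-suc n 0) (trans (sumTo-cong n term) (sym (neg-distrib-sumTo n _)))
  where
  term : ∀ k → S2 n k * (S1 (suc k) 0 - S1 (suc k) 1) ≡ - (S2 n k * S1 (suc k) 1)
  term k = trans (cong (λ z → S2 n k * (z - S1 (suc k) 1)) (S1-suc-zero k))
                 (solve 2 (λ a b → a :* (con 0ℚ :- b) := :- (a :* b)) refl (S2 n k) (S1 (suc k) 1))

mixedStirling-suc-suc : ∀ n j → mixedStirling (suc n) (suc j) ≡ mixedStirling n j - mixedStirling n (suc j)
mixedStirling-suc-suc n j = begin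
  mixedStirling (suc n) (suc j)
    ≡⟨ mixedStirling-suc n (suc j) ⟩
  sumTo n (λ k → S2 n k * (S1 (suc k) (suc j) - S1 (suc k) (suc (suc j))))
    ≡⟨ sumTo-cong n (λ k → solve 3 (λ s a b → s :* (a :- b) := s :* a :+ :- (s :* b)) refl (S2 n k) (S1 (suc k) (suc j)) (S1 (suc k) (suc (suc j)))) ⟩
  sumTo n (λ k → S2 n k * S1 (suc k) (suc j) + - (S2 n k * S1 (suc k) (suc (suc j))))
    ≡⟨ sumTo-+ n _ _ ⟩
  mixedStirling n j + sumTo n (λ k → - (S2 n k * S1 (suc k) (suc (suc j))))
    ≡⟨ cong (mixedStirling n j +_) (sym (neg-distrib-sumTo n _)) ⟩
  mixedStirling n j - mixedStirling n (suc j)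
    ∎

mixedStirling-vanish : ∀ n j → n < j → mixedStirling n j ≡ 0ℚ
mixedStirling-vanish n j n<j = sumTo-zero n _ (λ k k≤n →
  trans (cong (S2 n k *_) (S1-vanish (suc k) (suc j) (s≤s (ℕP.≤-<-trans k≤n n<j))))
        (solve 1 (λ a → a :* con 0ℚ := con 0ℚ) refl (S2 n k)))

signedBinomial : ℕ → ℕ → ℚ
signedBinomial i j = sgn i * (fact (i ℕ.+ j) * (invFact i * invFact j))

signedBinomial-zeroˡ : ∀ j → signedBinomial 0 j ≡ 1ℚ
signedBinomial-zeroˡ j = trans (solve 2 (λ f i → con 1ℚ :* (f :* (con 1ℚ :* i)) := f :* i) refl (fact j) (invFact j)) (fact*invFact j)

signedBinomial-zeroʳ : ∀ i → signedBinomial i 0 ≡ sgn i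
signedBinomial-zeroʳ i = begin
  sgn i * (fact (i ℕ.+ 0) * (invFact i * 1ℚ)) ≡⟨ cong (λ z → sgn i * (fact z * (invFact i * 1ℚ))) (ℕP.+-identityʳ i) ⟩
  sgn i * (fact i * (invFact i * 1ℚ))         ≡⟨ solve 3 (λ s f i → s :* (f :* (i :* con 1ℚ)) := s :* (f :* i)) refl (sgn i) (fact i) (invFact i) ⟩
  sgn i * (fact i * invFact i)                ≡⟨ cong (sgn i *_) (fact*invFact i) ⟩
  sgn i * 1ℚ                                  ≡⟨ solve 1 (λ s → s :* con 1ℚ := s) refl (sgn i) ⟩
  sgn i                                       ∎

signedBinomial-pascal : ∀ i j → signedBinomial (suc i) j - signedBinomial i (suc j) ≡ signedBinomial (suc i) (suc j)
signedBinomial-pascal i j rewrite ℕP.+-suc i j = begin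
  (- sgn i) * (fact N * (invFact (suc i) * invFact j)) - sgn i * (fact N * (invFact i * invFact (suc j)))
    ≡⟨ cong₂ (λ a b → (- sgn i) * (fact N * (invFact (suc i) * a)) - sgn i * (fact N * (b * invFact (suc j)))) (invFact-suc j) (invFact-suc i) ⟩
  (- sgn i) * (fact N * (invFact (suc i) * (fromℕ (suc j) * invFact (suc j)))) - sgn i * (fact N * ((fromℕ (suc i) * invFact (suc i)) * invFact (suc j)))
    ≡⟨ solve 6 (λ s F a b x y → (:- s) :* (F :* (a :* (y :* b))) :- s :* (F :* ((x :* a) :* b)) := (:- s) :* (((x :+ y) :* F) :* (a :* b))) refl (sgn i) (fact N) (invFact (suc i)) (invFact (suc j)) (fromℕ (suc i)) (fromℕ (suc j)) ⟩
  (- sgn i) * (((fromℕ (suc i) + fromℕ (suc j)) * fact N) * (invFact (suc i) * invFact (suc j)))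
    ≡⟨ cong (λ z → (- sgn i) * ((z * fact N) * (invFact (suc i) * invFact (suc j)))) (sym fromℕ-suc-N) ⟩
  (- sgn i) * ((fromℕ (suc N) * fact N) * (invFact (suc i) * invFact (suc j)))
    ≡⟨ cong (λ z → (- sgn i) * (z * (invFact (suc i) * invFact (suc j)))) (sym (fact-suc N)) ⟩
  (- sgn i) * (fact (suc N) * (invFact (suc i) * invFact (suc j)))
    ∎
  where
  N = suc (i ℕ.+ j)
  fromℕ-suc-N : fromℕ (suc N) ≡ fromℕ (suc i) + fromℕ (suc j)
  fromℕ-suc-N = trans (cong (fromℕ ∘ suc) (sym (ℕP.+-suc i j))) (fromℕ-+ (suc i) (suc j))

mixedStirling≡signedBinomial : ∀ i j → mixedStirling (i ℕ.+ j) j ≡ signedBinomial i j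
mixedStirling≡signedBinomial zero zero = refl
mixedStirling≡signedBinomial zero (suc j) = begin
  mixedStirling (suc j) (suc j)             ≡⟨ mixedStirling-suc-suc j j ⟩
  mixedStirling j j - mixedStirling j (suc j) ≡⟨ cong₂ _-_ (trans (mixedStirling≡signedBinomial zero j) (signedBinomial-zeroˡ j)) (mixedStirling-vanish j (suc j) ℕP.≤-refl) ⟩
  1ℚ - 0ℚ                                   ≡⟨ sym (signedBinomial-zeroˡ (suc j)) ⟩
  signedBinomial 0 (suc j)                  ∎
mixedStirling≡signedBinomial (suc i) zero = begin
  mixedStirling (suc (i ℕ.+ 0)) 0           ≡⟨ mixedStirling-suc-zero (i ℕ.+ 0) ⟩
  - mixedStirling (i ℕ.+ 0) 0               ≡⟨ cong -_ (trans (mixedStirling≡signedBinomial i 0) (signedBinomial-zeroʳ i)) ⟩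
  - sgn i                                   ≡⟨ sym (signedBinomial-zeroʳ (suc i)) ⟩
  signedBinomial (suc i) 0                  ∎
mixedStirling≡signedBinomial (suc i) (suc j) = begin
  mixedStirling (suc i ℕ.+ suc j) (suc j)                      ≡⟨ mixedStirling-suc-suc (i ℕ.+ suc j) j ⟩
  mixedStirling (i ℕ.+ suc j) j - mixedStirling (i ℕ.+ suc j) (suc j)
    ≡⟨ cong (λ z → mixedStirling z j - mixedStirling (i ℕ.+ suc j) (suc j)) (ℕP.+-suc i j) ⟩
  mixedStirling (suc i ℕ.+ j) j - mixedStirling (i ℕ.+ suc j) (suc j)
    ≡⟨ cong₂ _-_ (mixedStirling≡signedBinomial (suc i) j) (mixedStirling≡signedBinomial i (suc j)) ⟩
  signedBinomial (suc i) j - signedBinomial i (suc j)         ≡⟨ signedBinomial-pascal i j ⟩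
  signedBinomial (suc i) (suc j)                               ∎

fact*mixedStirling : ∀ {n j} → j ≤ n → fact j * mixedStirling n j ≡ sgn (n ∸ j) * (fact n * invFact (n ∸ j))
fact*mixedStirling {n} {j} j≤n = begin
  fact j * mixedStirling n j
    ≡⟨ cong (λ z → fact j * mixedStirling z j) (sym (ℕP.m∸n+n≡m j≤n)) ⟩
  fact j * mixedStirling (i ℕ.+ j) j
    ≡⟨ cong (fact j *_) (mixedStirling≡signedBinomial i j) ⟩
  fact j * (sgn i * (fact (i ℕ.+ j) * (invFact i * invFact j)))
    ≡⟨ solve 5 (λ fj s F a b → fj :* (s :* (F :* (a :* b))) := s :* (F :* a) :* (fj :* b)) refl (fact j) (sgn i) (fact (i ℕ.+ j)) (invFact i) (invFact j) ⟩
  sgn i * (fact (i ℕ.+ j) * invFact i) * (fact j * invFact j)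
    ≡⟨ cong₂ (λ z w → sgn i * (fact z * invFact i) * w) (ℕP.m∸n+n≡m j≤n) (fact*invFact j) ⟩
  sgn i * (fact n * invFact i) * 1ℚ
    ≡⟨ solve 1 (λ a → a :* con 1ℚ := a) refl _ ⟩
  sgn i * (fact n * invFact i)
    ∎
  where i = n ∸ j

der-as-sum : ∀ n → der n ≡ sumTo n (λ i → sgn i * (fact n * invFact i))
der-as-sum n = trans (*-distribˡ-sumTo n (fact n) _)
  (sumTo-cong n (λ i → solve 3 (λ f s a → f :* ((s :* a) :* con 1ℚ) := s :* (f :* a)) refl (fact n) (sgn i) (invFact i)))

bel-at-−1*S2 : ∀ {n k} → k ≤ n → bel (suc k) (- 1ℚ) * S2 n k ≡ - sumTo n (λ j → fact j * (S2 n k * S1 (suc k) (suc j)))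
bel-at-−1*S2 {n} {k} k≤n = begin
  bel (suc k) (- 1ℚ) * S2 n k             ≡⟨ cong (_* S2 n k) (bel-at-−1 k) ⟩
  (- sumTo k F) * S2 n k                  ≡⟨ cong (λ z → (- z) * S2 n k) (sumTo-extend F (ℕP.≤⇒≤′ k≤n) F-vanish) ⟩
  (- sumTo n F) * S2 n k                  ≡⟨ solve 2 (λ a b → (:- a) :* b := :- (b :* a)) refl (sumTo n F) (S2 n k) ⟩
  - (S2 n k * sumTo n F)                  ≡⟨ cong -_ (*-distribˡ-sumTo n (S2 n k) F) ⟩
  - sumTo n (λ j → S2 n k * F j)          ≡⟨ cong -_ (sumTo-cong n (λ j → solve 3 (λ s a b → s :* (a :* b) := a :* (s :* b)) refl (S2 n k) (fact j) (S1 (suc k) (suc j)))) ⟩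
  - sumTo n (λ j → fact j * (S2 n k * S1 (suc k) (suc j))) ∎
  where
  F : ℕ → ℚ
  F j = fact j * S1 (suc k) (suc j)
  F-vanish : ∀ j → k < j → F j ≡ 0ℚ
  F-vanish j k<j = trans (cong (fact j *_) (S1-vanish (suc k) (suc j) (s≤s k<j)))
                         (solve 1 (λ a → a :* con 0ℚ := con 0ℚ) refl (fact j))

theorem2 : (n : ℕ) → sumTo n (λ k → bel (suc k) (- 1ℚ) * S2 n k) ≡ - der n
theorem2 n = begin
  sumTo n (λ k → bel (suc k) (- 1ℚ) * S2 n k)
    ≡⟨ sumTo-cong≤ n (λ k → bel-at-−1*S2) ⟩
  sumTo n (λ k → - sumTo n (λ j → fact j * (S2 n k * S1 (suc k) (suc j))))
    ≡⟨ sym (neg-distrib-sumTo n _) ⟩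
  - sumTo n (λ k → sumTo n (λ j → fact j * (S2 n k * S1 (suc k) (suc j))))
    ≡⟨ cong -_ (sumTo-swap n n _) ⟩
  - sumTo n (λ j → sumTo n (λ k → fact j * (S2 n k * S1 (suc k) (suc j))))
    ≡⟨ cong -_ (sumTo-cong n (λ j → sym (*-distribˡ-sumTo n (fact j) _))) ⟩
  - sumTo n (λ j → fact j * mixedStirling n j)
    ≡⟨ cong -_ (sumTo-cong≤ n (λ j → fact*mixedStirling)) ⟩
  - sumTo n (λ j → d (n ∸ j))
    ≡⟨ cong -_ (trans (sumTo-reverse n d) (sym (der-as-sum n))) ⟩
  - der n
    ∎
  where
  d : ℕ → ℚ
  d i = sgn i * (fact n * invFact i)
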